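{- For all states $s,s'$ of the Findel execution model and every transaction $tx$: if $s\rightsquigarrow s'$ and $tx\in\mathcal{L}(s)$, then $tx\in\mathcal{L}(s')$.
   Context: Model of the Findel language. Addresses, identifiers and times are natural numbers. Primitives: $\mathtt{Zero}$, $\mathtt{One}(cur)$, $\mathtt{Scale}(k,P)$, $\mathtt{ScaleObs}(a,P)$, $\mathtt{Give}(P)$, $\mathtt{And}(P_1,P_2)$, $\mathtt{Or}(P_1,P_2)$, $\mathtt{If}(a,P_1,P_2)$, $\mathtt{Timebound}(t_0,t_1,P)$. A transaction is a record (id, contract id, from, to, amount, currency, timestamp). A contract $c$ has fields $\mathit{id}(c)$, $\mathit{dsc}(c)$, $\mathit{prim}(c)$, $\mathit{issuer}(c)$, $\mathit{owner}(c)$, proposed owner $\mathit{po}(c)$, scale $\mathit{sc}(c)$; a description $d$ has $\mathit{id}(d),\mathit{prim}(d),\mathit{sc}(d),\mathit{vfrom}(d),\mathit{vuntil}(d)$. $\mathrm{query}(\mathcal{G},a,t)$ returns $\mathtt{None}$ or $\mathtt{Some}\ v$. $\mathrm{execute}(P,sc,I,O,B,t,\mathcal{G},cid,did,n,L)$ returns $\bot$ or $(B',C',n',L')$: $\mathtt{Zero}\mapsto(B,[],n,L)$; $\mathtt{One}(cur)\mapsto(B'',[],n+1,tx::L)$ with $B''$ moving $sc$ units of $cur$ from $I$ to $O$ and $tx$ the transaction (id $n$, contract id $cid$, from $I$, to $O$, amount $sc$, currency $cur$, time $t$); $\mathtt{Scale}(k,P')$ executes $P'$ with scale $sc\cdot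 k$; $\mathtt{ScaleObs}(a,P')$ is $\bot$ if the query of $a$ at $t$ fails, else executes $P'$ with scale $sc\cdot v$; $\mathtt{Give}(P')$ executes $P'$ with $I,O$ swapped; $\mathtt{And}(P_1,P_2)$ executes $P_1$ then $P_2$ threading balance, fresh id and ledger, concatenating generated contracts, $\bot$ if either fails; $\mathtt{If}(a,P_1,P_2)$ is $\bot$ if the query fails, executes $P_2$ if the value is $0$, else $P_1$; $\mathtt{Timebound}(t_0,t_1,P')$ is $\bot$ if $t_1<t$, executes $P'$ if $t_0<t\le t_1$, else returns $(B,[c'],n+2,L)$ with $c'$ = (id $n+1$, description $did$, primitive $\mathtt{Timebound}(t_0,t_1,P')$, issuer $I$, owner $O$, proposed owner $O$, scale $sc$); $\mathtt{Or}(P_1,P_2)\mapsto(B,[c'],n+2,L)$ with $c'$ = (id $n+1$, description $did$, primitive $\mathtt{Or}(P_1,P_2)$, issuer $I$, owner $O$, proposed owner $O$, scale $sc$). A state is $s=\langle\mathcal{C},\mathcal{D},\mathcal{B},t,\mathcal{G},i,\mathcal{L},\mathtt{E}\rangle$ (issued contracts, descriptions, balance, time, gateways, fresh id, ledger $\mathcal{L}(s)$, events). Steps $s\curvearrowright s'$: [Issue] for $d\in\mathcal{D}$, addresses $I,O$: prepend contract (id $i$, description $\mathit{id}(d)$, primitive $\mathit{prim}(d)$, issuer $I$, owner $I$, proposed owner $O$, scale $\mathit{sc}(d)$), fresh id $i+1$, prepend event $\mathtt{IssuedFor}\ O\ i$. [Join] for $c\in\mathcal{C}$, address $O$, with $\mathit{po}(c)\in\{O,0\}$,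 $\mathit{prim}(c)$ not an $\mathtt{Or}$, the description $d$ of $c$ satisfying $\mathit{vfrom}(d)\le t\le\mathit{vuntil}(d)$, and $\mathrm{execute}(\mathit{prim}(c),\mathit{sc}(c),\mathit{issuer}(c),O,\mathcal{B},t,\mathcal{G},\mathit{id}(c),\mathit{dsc}(c),i,\mathcal{L})=(\mathcal{B}',\mathcal{C}',i',\mathcal{L}')$: new contracts $(\mathcal{C}\setminus\{c\})\cup\mathcal{C}'$, balance $\mathcal{B}'$, fresh id $i'$, ledger $\mathcal{L}'$, prepend event $\mathtt{Executed}\ \mathit{id}(c)$. [Join Or] as Join but with $\mathit{prim}(c)=\mathtt{Or}(P_1,P_2)$, executing a chosen $P\in\{P_1,P_2\}$. [Fail] under the proposed-owner and validity-time conditions, if the corresponding execution returns $\bot$: remove $c$, prepend $\mathtt{Deleted}\ \mathit{id}(c)$, all else unchanged. [Tick] time $t\mapsto t+1$. $\rightsquigarrow$ is the reflexive–transitive closure of $\curvearrowright$. -}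

module Defs where

open import Data.Nat using (ℕ; zero; suc; _+_; _*_; _≤_; _<_; _≟_; _<?_; _≤?_)
open import Data.Integer as ℤ using (ℤ; +_)
open import Data.Bool using (Bool; true; false; if_then_else_; _∧_)
open import Data.Maybe using (Maybe; just; nothing)
open import Data.List using (List; []; _∷_; _++_)
open import Data.Product using (_×_; _,_; Σ; ∃)
open import Data.Sum using (_⊎_)
open import Relation.Nullary using (yes; no; ¬_)
open import Relation.Nullary.Decidable using (⌊_⌋)
open import Relation.Binary.PropositionalEquality using (_≡_)
open import Data.List.Membership.Propositional using (_∈_)

Address Id Time Currency : Set
Address = ℕ
Id = ℕ
Time = ℕ
Currency = ℕ

data Prim : Set where
  Zero     : Prim
  One      : Currency → Prim
  Scale    : ℕ → Prim → Prim
  ScaleObs : Address → Prim → Prim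
  Give     : Prim → Prim
  And      : Prim → Prim → Prim
  Or       : Prim → Prim → Prim
  If       : Address → Prim → Prim → Prim
  Timebound : Time → Time → Prim → Prim

record Transaction : Set where
  constructor mkTx
  field
    txId    : Id
    txCid   : Id
    txFrom  : Address
    txTo    : Address
    txAmount : ℕ
    txCur   : Currency
    txTime  : Time

record Contract : Set where
  constructor mkContract
  field
    id     : Id
    dsc    : Id
    prim   : Prim
    issuer : Address
    owner  : Address
    po     : Address
    sc     : ℕ

record Description : Set where
  constructor mkDesc
  field
    did    : Id
    dprim  : Prim
    dsc'   : ℕ
    vfrom  : Time
    vuntil : Time

Balance : Set
Balance = Address → Currency → ℤ

Gateways : Set
Gateways = Address → Time → Maybe ℕ

query : Gateways → Address → Time → Maybe ℕ
query G a t = G a t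

adjust : Balance → Address → Currency → ℤ → Balance
adjust B a cur k x c = if ⌊ x ≟ a ⌋ ∧ ⌊ c ≟ cur ⌋ then B x c ℤ.+ k else B x c

transfer : Balance → Address → Address → Currency → ℕ → Balance
transfer B I O cur amt = adjust (adjust B I cur (ℤ.- (+ amt))) O cur (+ amt)

Result : Set
Result = Balance × List Contract × ℕ × List Transaction

execute : Prim → ℕ → Address → Address → Balance → Time → Gateways →
          Id → Id → ℕ → List Transaction → Maybe Result
execute Zero sc I O B t G cid did n L = just (B , [] , n , L)
execute (One cur) sc I O B t G cid did n L =
  just (transfer B I O cur sc , [] , suc n , mkTx n cid I O sc cur t ∷ L)
execute (Scale k P) sc I O B t G cid did n L = execute P (sc * k) I O B t G cid did n L
execute (ScaleObs a P) sc I O B t G cid did n L with query G a t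
... | nothing = nothing
... | just v  = execute P (sc * v) I O B t G cid did n L
execute (Give P) sc I O B t G cid did n L = execute P sc O I B t G cid did n L
execute (And P₁ P₂) sc I O B t G cid did n L with execute P₁ sc I O B t G cid did n L
... | nothing = nothing
... | just (B₁ , C₁ , n₁ , L₁) with execute P₂ sc I O B₁ t G cid did n₁ L₁
...   | nothing = nothing
...   | just (B₂ , C₂ , n₂ , L₂) = just (B₂ , C₁ ++ C₂ , n₂ , L₂)
execute (If a P₁ P₂) sc I O B t G cid did n L with query G a t
... | nothing = nothing
... | just zero    = execute P₂ sc I O B t G cid did n L
... | just (suc _) = execute P₁ sc I O B t G cid did n L
execute (Timebound t₀ t₁ P) sc I O B t G cid did n L with t₁ <? t
... | yes _ = nothing
... | no _ with t₀ <? t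
...   | yes _ = execute P sc I O B t G cid did n L
...   | no _  = just (B , mkContract (suc n) did (Timebound t₀ t₁ P) I O O sc ∷ [] , suc (suc n) , L)
execute (Or P₁ P₂) sc I O B t G cid did n L =
  just (B , mkContract (suc n) did (Or P₁ P₂) I O O sc ∷ [] , suc (suc n) , L)

data Event : Set where
  IssuedFor : Address → Id → Event
  Executed  : Id → Event
  Deleted   : Id → Event

record State : Set where
  constructor ⟨_,_,_,_,_,_,_,_⟩
  field
    contracts : List Contract
    descs     : List Description
    balance   : Balance
    time      : Time
    gateways  : Gateways
    freshId   : ℕ
    ledger    : List Transaction
    events    : List Event

open Contract
open Description

IsOr : Prim → Set
IsOr (Or _ _) = Data.Unit.⊤ where import Data.Unit
IsOr _ = Data.Empty.⊥ where import Data.Empty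

POk : Contract → Address → Set
POk c O = (po c ≡ O) ⊎ (po c ≡ 0)

ValidDesc : List Description → Contract → Time → Description → Set
ValidDesc D c t d = d ∈ D × did d ≡ dsc c × vfrom d ≤ t × t ≤ vuntil d

-- the primitive executed when joining c: prim c itself (not an Or),
-- or a chosen branch of an Or
data Chosen : Prim → Prim → Set where
  notOr : ∀ {P} → ¬ IsOr P → Chosen P P
  left  : ∀ {P₁ P₂} → Chosen (Or P₁ P₂) P₁
  right : ∀ {P₁ P₂} → Chosen (Or P₁ P₂) P₂

-- the contract set is a list; c ∈ C is witnessed by a split C = C₁ ++ c ∷ C₂,
-- and C \ {c} is C₁ ++ C₂.
data _↷_ : State → State → Set where
  issue : ∀ {C D B t G i L E} (d : Description) (I O : Address) → d ∈ D →
    ⟨ C , D , B , t , G , i , L , E ⟩ ↷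
    ⟨ mkContract i (did d) (dprim d) I I O (dsc' d) ∷ C , D , B , t , G , suc i , L , IssuedFor O i ∷ E ⟩
  join : ∀ {C₁ C₂ D B t G i L E} (c : Contract) (O : Address) (d : Description) (P : Prim)
    {B' C' i' L'} →
    POk c O → ValidDesc D c t d → Chosen (prim c) P →
    execute P (sc c) (issuer c) O B t G (id c) (dsc c) i L ≡ just (B' , C' , i' , L') →
    ⟨ C₁ ++ c ∷ C₂ , D , B , t , G , i , L , E ⟩ ↷
    ⟨ (C₁ ++ C₂) ++ C' , D , B' , t , G , i' , L' , Executed (id c) ∷ E ⟩
  fail : ∀ {C₁ C₂ D B t G i L E} (c : Contract) (O : Address) (d : Description) (P : Prim) →
    POk c O → ValidDesc D c t d → Chosen (prim c) P →
    execute P (sc c) (issuer c) O B t G (id c) (dsc c) i L ≡ nothing →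
    ⟨ C₁ ++ c ∷ C₂ , D , B , t , G , i , L , E ⟩ ↷
    ⟨ C₁ ++ C₂ , D , B , t , G , i , L , Deleted (id c) ∷ E ⟩
  tick : ∀ {C D B t G i L E} →
    ⟨ C , D , B , t , G , i , L , E ⟩ ↷ ⟨ C , D , B , suc t , G , i , L , E ⟩

data _↝_ : State → State → Set where
  done : ∀ {s} → s ↝ s
  step : ∀ {s s' s''} → s ↷ s' → s' ↝ s'' → s ↝ s''

module Submission where

-- The proof establishes a stronger, structural invariant.  Say that a ledger
-- L' extends L when L' = new ++ L for some list of new transactions, i.e. the
-- old ledger is a suffix of the new one.
-- The theorem is then the membership-preservation of extension.

open import Defs
open import Data.List using (List; []; _∷_; _++_)
open import Data.List.Properties using (++-assoc)
open import Data.List.Membership.Propositional using (_∈_)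
open import Data.List.Membership.Propositional.Properties using (∈-++⁺ʳ)
open import Data.Maybe using (just)
open import Data.Nat using (zero; suc; _<?_)
open import Data.Product using (∃; _,_)
open import Relation.Nullary using (yes; no)
open import Relation.Binary.PropositionalEquality using (_≡_; refl; sym)

_⊒_ : List Transaction → List Transaction → Set
L' ⊒ L = ∃ λ new → L' ≡ new ++ L

⊒-refl : ∀ {L} → L ⊒ L
⊒-refl = [] , refl

⊒-∷ : ∀ {L} tx → (tx ∷ L) ⊒ L
⊒-∷ tx = tx ∷ [] , refl

⊒-trans : ∀ {L₁ L₂ L₃} → L₃ ⊒ L₂ → L₂ ⊒ L₁ → L₃ ⊒ L₁
⊒-trans {L₁} (new₃ , refl) (new₂ , refl) = new₃ ++ new₂ , sym (++-assoc new₃ new₂ L₁)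

⊒-preserves-∈ : ∀ {L L' tx} → L' ⊒ L → tx ∈ L → tx ∈ L'
⊒-preserves-∈ (new , refl) = ∈-++⁺ʳ new

execute-extends : ∀ P sc I O B t G cid did n L {B' C' n' L'} →
  execute P sc I O B t G cid did n L ≡ just (B' , C' , n' , L') → L' ⊒ L
execute-extends Zero sc I O B t G cid did n L refl = ⊒-refl
execute-extends (One cur) sc I O B t G cid did n L refl = ⊒-∷ _
execute-extends (Scale k P) sc I O B t G cid did n L ok =
  execute-extends P _ I O B t G cid did n L ok
execute-extends (ScaleObs a P) sc I O B t G cid did n L ok with query G a t
... | just v = execute-extends P _ I O B t G cid did n L ok
execute-extends (Give P) sc I O B t G cid did n L ok =
  execute-extends P sc O I B t G cid did n L ok
execute-extends (And P₁ P₂) sc I O B t G cid did n L ok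
  with execute P₁ sc I O B t G cid did n L in ok₁
... | just (B₁ , C₁ , n₁ , L₁) with execute P₂ sc I O B₁ t G cid did n₁ L₁ in ok₂
...   | just (B₂ , C₂ , n₂ , L₂) with ok
...     | refl = ⊒-trans (execute-extends P₂ sc I O B₁ t G cid did n₁ L₁ ok₂)
                         (execute-extends P₁ sc I O B t G cid did n L ok₁)
execute-extends (Or P₁ P₂) sc I O B t G cid did n L refl = ⊒-refl
execute-extends (If a P₁ P₂) sc I O B t G cid did n L ok with query G a t
... | just zero    = execute-extends P₂ sc I O B t G cid did n L ok
... | just (suc _) = execute-extends P₁ sc I O B t G cid did n L ok
execute-extends (Timebound t₀ t₁ P) sc I O B t G cid did n L ok with t₁ <? t
... | no _ with t₀ <? t
...   | yes _ = execute-extends P sc I O B t G cid did n L ok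
...   | no _ with ok
...     | refl = ⊒-refl

step-extends : ∀ {s s'} → s ↷ s' → State.ledger s' ⊒ State.ledger s
step-extends (issue d I O d∈D) = ⊒-refl
step-extends (join c O d P po-ok valid chosen ok) =
  execute-extends P _ _ O _ _ _ _ _ _ _ ok
step-extends (fail c O d P po-ok valid chosen failed) = ⊒-refl
step-extends tick = ⊒-refl

reachable-extends : ∀ {s s'} → s ↝ s' → State.ledger s' ⊒ State.ledger s
reachable-extends done = ⊒-refl
reachable-extends (step s↷s₁ s₁↝s') =
  ⊒-trans (reachable-extends s₁↝s') (step-extends s↷s₁)

theorem2 : (s s' : State) (tx : Transaction) →
    s ↝ s' → tx ∈ State.ledger s → tx ∈ State.ledger s'
theorem2 s s' tx s↝s' = ⊒-preserves-∈ (reachable-extends s↝s')
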